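{- Let $S\subset\mathbb{P}^6_{\mathbb{Q}}$ be the surface defined by $$x_3^2+x_0x_5+x_1x_6=x_2x_3-x_0x_6=x_1x_2+x_0x_3+x_0x_4=0,$$ $$x_3x_5+x_4x_5+x_6^2=x_2x_5-x_4x_6=x_1x_5-x_3x_6=0,$$ $$x_4^2+x_0x_5+x_2x_6=x_3x_4-x_0x_5=x_1x_4-x_0x_6=0,$$ and $U=S\setminus(L_1\cup L_2)$ with $L_1=\{x_1=x_3=x_4=x_5=x_6=0\}$, $L_2=\{x_2=x_3=x_4=x_5=x_6=0\}$. For $(\boldsymbol\alpha,\boldsymbol\eta)=(\alpha_1,\alpha_2,\alpha_3,\eta_1,\eta_2,\eta_3,\eta_4)$ satisfying $\eta_2\alpha_1^2+\eta_3\alpha_2+\eta_4\alpha_3=0$ and $\eta_1\eta_2\eta_3\eta_4\neq0$ put $$\pi(\boldsymbol\alpha,\boldsymbol\eta)=(\alpha_2\alpha_3:\eta_1\eta_2\eta_3\alpha_1\alpha_2:\eta_1\eta_2\eta_4\alpha_1\alpha_3:\eta_1^2\eta_2\eta_3^2\eta_4\alpha_2:\eta_1^2\eta_2\eta_3\eta_4^2\alpha_3:\eta_1^4\eta_2^2\eta_3^3\eta_4^3:\eta_1^3\eta_2^2\eta_3^2\eta_4^2\alpha_1)\in S.$$ Then for each rational point $x\in U(\mathbb{Q})$ all of whose coordinates are non-zero, there is a unique $(\boldsymbol\alpha,\boldsymbol\eta)\in\mathbb{Z}^7$ with $\eta_2\alpha_1^2+\eta_3\alpha_2+\eta_4\alpha_3=0$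 and $\pi(\boldsymbol\alpha,\boldsymbol\eta)=x$ satisfying $$(\alpha_1,\eta_1\eta_3\eta_4)=(\alpha_2,\eta_1\eta_2\eta_4)=(\alpha_3,\eta_1\eta_2\eta_3)=1,$$ $$(\eta_2,\eta_3)=(\eta_2,\eta_4)=(\eta_3,\eta_4)=1,$$ $$\eta_1,\eta_2,\eta_3,\eta_4>0,\qquad \alpha_1\alpha_2\alpha_3\neq0.$$
   Context: $(a,b)$ denotes the greatest common divisor of integers $a,b$. The affine variety $\eta_2\alpha_1^2+\eta_3\alpha_2+\eta_4\alpha_3=0$ in $\mathbb{A}^7$ (with $\eta_1\eta_2\eta_3\eta_4\ne0$) together with $\pi$ is the universal torsor over $U$ of the minimal desingularisation of $S$. -}

module Defs where

open import Data.Integer using (ℤ; +_; _+_; _*_; -_; 0ℤ; 1ℤ; _>_)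
open import Data.Integer.GCD using (gcd)
open import Data.Fin using (Fin)
open import Data.Vec using (Vec; []; _∷_; lookup)
open import Data.Product using (_×_; Σ; ∃)
open import Relation.Binary.PropositionalEquality using (_≡_)
open import Relation.Nullary using (¬_)

Coords : Set
Coords = Fin 7 → ℤ

mk : ℤ → ℤ → ℤ → ℤ → ℤ → ℤ → ℤ → Coords
mk a b c d e f g = lookup (a ∷ b ∷ c ∷ d ∷ e ∷ f ∷ g ∷ [])

OnS : Coords → Set
OnS x =
  (x3 * x3 + x0 * x5 + x1 * x6 ≡ 0ℤ) ×
  (x2 * x3 + - (x0 * x6) ≡ 0ℤ) ×
  (x1 * x2 + x0 * x3 + x0 * x4 ≡ 0ℤ) ×
  (x3 * x5 + x4 * x5 + x6 * x6 ≡ 0ℤ) ×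
  (x2 * x5 + - (x4 * x6) ≡ 0ℤ) ×
  (x1 * x5 + - (x3 * x6) ≡ 0ℤ) ×
  (x4 * x4 + x0 * x5 + x2 * x6 ≡ 0ℤ) ×
  (x3 * x4 + - (x0 * x5) ≡ 0ℤ) ×
  (x1 * x4 + - (x0 * x6) ≡ 0ℤ)
  where
  x0 = x Fin.zero
  x1 = x (Fin.suc Fin.zero)
  x2 = x (Fin.suc (Fin.suc Fin.zero))
  x3 = x (Fin.suc (Fin.suc (Fin.suc Fin.zero)))
  x4 = x (Fin.suc (Fin.suc (Fin.suc (Fin.suc Fin.zero))))
  x5 = x (Fin.suc (Fin.suc (Fin.suc (Fin.suc (Fin.suc Fin.zero)))))
  x6 = x (Fin.suc (Fin.suc (Fin.suc (Fin.suc (Fin.suc (Fin.suc Fin.zero))))))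

-- all coordinates non-zero (this also forces x ∉ L1 ∪ L2 and x ≠ 0)
AllNonzero : Coords → Set
AllNonzero x = ∀ i → ¬ (x i ≡ 0ℤ)

-- equality of points in P^6: λ y = μ x with λ, μ non-zero integers
-- (equivalently, y = (μ/λ) x for a non-zero rational scalar)
ProjEq : Coords → Coords → Set
ProjEq y x = Σ ℤ λ l → Σ ℤ λ m → ¬ (l ≡ 0ℤ) × ¬ (m ≡ 0ℤ) × (∀ i → l * y i ≡ m * x i)

record Tor : Set where
  constructor tor
  field
    a1 a2 a3 e1 e2 e3 e4 : ℤ
open Tor public

TorEq : Tor → Set
TorEq t = e2 t * (a1 t * a1 t) + e3 t * a2 t + e4 t * a3 t ≡ 0ℤ

π : Tor → Coords
π (tor α1 α2 α3 η1 η2 η3 η4) = mk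
  (α2 * α3)
  (η1 * η2 * η3 * α1 * α2)
  (η1 * η2 * η4 * α1 * α3)
  (η1 * η1 * η2 * η3 * η3 * η4 * α2)
  (η1 * η1 * η2 * η3 * η4 * η4 * α3)
  (η1 * η1 * η1 * η1 * η2 * η2 * η3 * η3 * η3 * η4 * η4 * η4)
  (η1 * η1 * η1 * η2 * η2 * η3 * η3 * η4 * η4 * α1)

Conds : Tor → Set
Conds (tor α1 α2 α3 η1 η2 η3 η4) =
  (gcd α1 (η1 * η3 * η4) ≡ 1ℤ) ×
  (gcd α2 (η1 * η2 * η4) ≡ 1ℤ) ×
  (gcd α3 (η1 * η2 * η3) ≡ 1ℤ) ×
  (gcd η2 η3 ≡ 1ℤ) × (gcd η2 η4 ≡ 1ℤ) × (gcd η3 η4 ≡ 1ℤ) ×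
  (η1 > 0ℤ) × (η2 > 0ℤ) × (η3 > 0ℤ) × (η4 > 0ℤ) ×
  ¬ (α1 * α2 * α3 ≡ 0ℤ)

Good : Coords → Tor → Set
Good x t = TorEq t × ProjEq (π t) x × Conds t

-- Up to scaling, π(α, η) is determined by the three ratios α₁/d₁ = x₆/x₅,
-- α₂/d₂ = d₁x₃/x₅ and α₃/d₃ = d₁x₄/x₅, where d₁ = η₁η₃η₄, d₂ = η₁η₂η₄, d₃ = η₁η₂η₃:
-- the remaining coordinates follow through the binomial equations x₀x₅ = x₃x₄,
-- x₁x₅ = x₃x₆, x₂x₅ = x₄x₆ of S. The coprimality conditions say exactly that these
-- ratios are in lowest terms, which gives uniqueness, and the dᵢ determine the ηᵢ since
-- η₂, η₃, η₄ are pairwise coprime. Conversely, write x₆/x₅, d₁x₃/x₅, d₁x₄/x₅ in lowest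
-- terms: the quadric x₃x₅ + x₄x₅ + x₆² = 0 becomes α₁²d₂d₃ + α₂d₁d₃ + α₃d₁d₂ = 0. After
-- removing η₁ = gcd(d₁, d₂, d₃), coprimality with the αᵢ makes each dᵢ/η₁ divide the
-- product of the other two, so d₁/η₁ = η₃η₄, d₂/η₁ = η₂η₄, d₃/η₁ = η₂η₃ with η₂, η₃, η₄
-- pairwise coprime, and the equation becomes the torsor equation.
module Submission where

open import Defs
open import Data.Product using (Σ; _×_; _,_; proj₁; proj₂)
open import Relation.Binary.PropositionalEquality

module CoprimeTriples where

  open import Data.Nat.Base using (ℕ; _*_; NonZero; ≢-nonZero; ≢-nonZero⁻¹)
  open import Data.Nat.Properties using (*-comm; *-assoc; *-identityˡ; m*n≢0⇒m≢0; m*n≢0⇒n≢0)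
  open import Data.Nat.Divisibility
  open import Data.Nat.GCD
  open import Data.Nat.Coprimality using (Coprime; coprime-divisor; GCD≡1⇒coprime)
    renaming (sym to ⊥-sym)
  open import Data.Sum using (inj₁)

  Coprime₃ : ℕ → ℕ → ℕ → Set
  Coprime₃ a b c = ∀ {d} → d ∣ a → d ∣ b → d ∣ c → d ≡ 1

  coprime-∣ʳ : ∀ {m n k} → Coprime m n → k ∣ n → Coprime m k
  coprime-∣ʳ m⊥n k∣n (d∣m , d∣k) = m⊥n (d∣m , ∣-trans d∣k k∣n)

  coprime-*-∣ : ∀ {m n k} → Coprime m n → m ∣ k → n ∣ k → m * n ∣ k
  coprime-*-∣ {m} {n} m⊥n (divides q refl) n∣qm =
    subst (m * n ∣_) (*-comm m q) (*-monoʳ-∣ m (coprime-divisor (⊥-sym m⊥n) n∣mq))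
    where
    n∣mq : n ∣ m * q
    n∣mq = subst (n ∣_) (*-comm q m) n∣qm

  gcd≢0ˡ : ∀ a b → .{{NonZero a}} → NonZero (gcd a b)
  gcd≢0ˡ a b = ≢-nonZero (gcd[m,n]≢0 a b (inj₁ (≢-nonZero⁻¹ a)))

  ≡*⇒nonZero : ∀ {k} m n → NonZero k → k ≡ m * n → NonZero m × NonZero n
  ≡*⇒nonZero m n k≢0 refl = m*n≢0⇒m≢0 m {{k≢0}} , m*n≢0⇒n≢0 m {{k≢0}}

  ≡*⇒∣ : ∀ {k} m n → k ≡ m * n → m ∣ k
  ≡*⇒∣ m n k≡mn = divides n (trans k≡mn (*-comm m n))

  -- Writing a = e p and b = e q with e = gcd a b, p and q are coprime, so a ∣ b c forces p ∣ c.
  ∣*⇒∣gcd*gcd : ∀ a b c → .{{NonZero a}} → a ∣ b * c → a ∣ gcd a b * gcd a c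
  ∣*⇒∣gcd*gcd a b c a∣bc = subst (_∣ e * gcd a c) (sym a≡ep) (*-monoʳ-∣ e p∣gcd)
    where
    e = gcd a b
    instance e≢0 = gcd≢0ˡ a b
    e∣a = gcd[m,n]∣m a b
    e∣b = gcd[m,n]∣n a b
    p = quotient e∣a
    q = quotient e∣b
    a≡ep : a ≡ e * p
    a≡ep = trans (m∣n⇒n≡quotient*m e∣a) (*-comm p e)
    b≡eq : b ≡ e * q
    b≡eq = trans (m∣n⇒n≡quotient*m e∣b) (*-comm q e)
    p⊥q : Coprime p q
    p⊥q = GCD≡1⇒coprime (GCD-* (subst₂ (λ a′ b′ → GCD a′ b′ (1 * e))
      (m∣n⇒n≡quotient*m e∣a) (m∣n⇒n≡quotient*m e∣b)
      (subst (GCD a b) (sym (*-identityˡ e)) (gcd-GCD a b))))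
    ep∣eqc : e * p ∣ e * (q * c)
    ep∣eqc = subst₂ _∣_ a≡ep (trans (cong (_* c) b≡eq) (*-assoc e q c)) a∣bc
    p∣gcd : p ∣ gcd a c
    p∣gcd = gcd-greatest (quotient-∣ e∣a) (coprime-divisor p⊥q (*-cancelˡ-∣ e ep∣eqc))

  ∣*⇒≡gcd*gcd : ∀ a b c → .{{NonZero a}} → Coprime (gcd a b) (gcd a c) →
    a ∣ b * c → a ≡ gcd a b * gcd a c
  ∣*⇒≡gcd*gcd a b c ⊥ a∣bc =
    ∣-antisym (∣*⇒∣gcd*gcd a b c a∣bc) (coprime-*-∣ ⊥ (gcd[m,n]∣m a b) (gcd[m,n]∣m a c))

  coprime₃-rotate : ∀ {a b c} → Coprime₃ a b c → Coprime₃ b c a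
  coprime₃-rotate ⊥₃ d∣b d∣c d∣a = ⊥₃ d∣a d∣b d∣c

  coprime₃⇒coprime-gcd : ∀ {a b c} → Coprime₃ a b c → Coprime (gcd a b) (gcd a c)
  coprime₃⇒coprime-gcd {a} {b} {c} ⊥₃ (d∣ab , d∣ac) =
    ⊥₃ (∣-trans d∣ab (gcd[m,n]∣m a b)) (∣-trans d∣ab (gcd[m,n]∣n a b)) (∣-trans d∣ac (gcd[m,n]∣n a c))

  MutuallyDividing : ℕ → ℕ → ℕ → Set
  MutuallyDividing a b c = (a ∣ b * c) × (b ∣ a * c) × (c ∣ a * b)

  record PairwiseCoprimeFactorisation (a b c : ℕ) : Set where
    field
      u v w : ℕ
      a≡v*w : a ≡ v * w
      b≡u*w : b ≡ u * w
      c≡u*v : c ≡ u * v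
      u⊥v : Coprime u v
      u⊥w : Coprime u w
      v⊥w : Coprime v w

  mutuallyDividing⇒factorisation : ∀ a b c → .{{NonZero a}} → .{{NonZero b}} → .{{NonZero c}} →
    Coprime₃ a b c → MutuallyDividing a b c → PairwiseCoprimeFactorisation a b c
  mutuallyDividing⇒factorisation a b c ⊥₃ (a∣bc , b∣ac , c∣ab) = record
    { u = gcd b c ; v = gcd a c ; w = gcd a b
    ; a≡v*w = ∣*⇒≡gcd*gcd a c b (⊥-sym (coprime₃⇒coprime-gcd ⊥₃)) (subst (a ∣_) (*-comm b c) a∣bc)
    ; b≡u*w = trans (∣*⇒≡gcd*gcd b c a (coprime₃⇒coprime-gcd (coprime₃-rotate ⊥₃)) (subst (b ∣_) (*-comm a c) b∣ac))
                    (cong (gcd b c *_) (gcd-comm b a))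
    ; c≡u*v = trans (∣*⇒≡gcd*gcd c b a (⊥-sym (coprime₃⇒coprime-gcd (coprime₃-rotate (coprime₃-rotate ⊥₃))))
                                       (subst (c ∣_) (*-comm a b) c∣ab))
                    (cong₂ _*_ (gcd-comm c b) (gcd-comm c a))
    ; u⊥v = λ (d∣u , d∣v) →
        ⊥₃ (∣-trans d∣v (gcd[m,n]∣m a c)) (∣-trans d∣u (gcd[m,n]∣m b c)) (∣-trans d∣u (gcd[m,n]∣n b c))
    ; u⊥w = λ (d∣u , d∣w) →
        ⊥₃ (∣-trans d∣w (gcd[m,n]∣m a b)) (∣-trans d∣u (gcd[m,n]∣m b c)) (∣-trans d∣u (gcd[m,n]∣n b c))
    ; v⊥w = coprime₃⇒coprime-gcd (λ d∣a d∣c d∣b → ⊥₃ d∣a d∣b d∣c)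
    }

  record CommonFactorSplit (a b c : ℕ) : Set where
    field
      g a′ b′ c′ : ℕ
      g≢0 : NonZero g
      a≡a′*g : a ≡ a′ * g
      b≡b′*g : b ≡ b′ * g
      c≡c′*g : c ≡ c′ * g
      coprime₃ : Coprime₃ a′ b′ c′

  splitCommonFactor : ∀ a b c → .{{NonZero a}} → CommonFactorSplit a b c
  splitCommonFactor a b c = record
    { g = g ; a′ = quotient g∣a ; b′ = quotient g∣b ; c′ = quotient g∣c
    ; g≢0 = gcd≢0ˡ a (gcd b c)
    ; a≡a′*g = m∣n⇒n≡quotient*m g∣a
    ; b≡b′*g = m∣n⇒n≡quotient*m g∣b
    ; c≡c′*g = m∣n⇒n≡quotient*m g∣c
    ; coprime₃ = coprime₃
    }
    where
    g = gcd a (gcd b c)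
    instance g≢0 = gcd≢0ˡ a (gcd b c)
    g∣a = gcd[m,n]∣m a (gcd b c)
    g∣b = ∣-trans (gcd[m,n]∣n a (gcd b c)) (gcd[m,n]∣m b c)
    g∣c = ∣-trans (gcd[m,n]∣n a (gcd b c)) (gcd[m,n]∣n b c)
    coprime₃ : Coprime₃ (quotient g∣a) (quotient g∣b) (quotient g∣c)
    coprime₃ {d} d∣a′ d∣b′ d∣c′ = ∣1⇒≡1 (*-cancelʳ-∣ g dg∣1g)
      where
      lift : ∀ {n} (g∣n : g ∣ n) → d ∣ quotient g∣n → d * g ∣ n
      lift g∣n d∣n′ = subst (d * g ∣_) (sym (m∣n⇒n≡quotient*m g∣n)) (*-monoˡ-∣ g d∣n′)
      dg∣1g : d * g ∣ 1 * g
      dg∣1g = subst (d * g ∣_) (sym (*-identityˡ g))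
        (gcd-greatest (lift g∣a d∣a′) (gcd-greatest (lift g∣b d∣b′) (lift g∣c d∣c′)))

open CoprimeTriples

open import Data.Nat.Base as ℕ using (ℕ; suc; NonZero; s≤s; z≤n)
open import Data.Nat.Divisibility using (_∣_; divides; ∣-antisym)
open import Data.Nat.Coprimality using (Coprime; recompute; coprime-divisor; coprime⇒gcd≡1; gcd≡1⇒coprime)
  renaming (sym to ⊥-sym)
open import Data.Integer.Base
  using (ℤ; +_; +[1+_]; -[1+_]; +0; _+_; _*_; -_; 0ℤ; 1ℤ; ∣_∣; _>_; +<+; ≢-nonZero)
open import Data.Integer.GCD using (gcd)
open import Data.Integer.Properties
  using ( *-comm; *-assoc; *-zeroʳ; +-identityˡ; *-cancelˡ-≡; *-cancelʳ-≡; i*j≡0⇒i≡0∨j≡0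
        ; neg-distribʳ-*; neg-involutive; abs-*; pos-*; +-injective; i-j≡0⇒i≡j; *-commutativeSemigroup)
import Data.Integer.Divisibility as ℤ
import Data.Integer.Divisibility.Signed as ℤˢ
import Data.Integer.Coprimality as ℤ
open import Data.Integer.Tactic.RingSolver using (solve-∀; solve)
open import Algebra.Properties.CommutativeSemigroup *-commutativeSemigroup using (x∙yz≈y∙xz; xy∙z≈xz∙y)
open import Data.Rational.Base using (ℚ; mkℚ; ↥_; ↧_; ↧ₙ_; _/_)
open import Data.Rational.Properties using (↥-/; ↧-/)
open import Data.List.Base using (_∷_; [])
open import Data.Fin.Patterns using (0F; 1F; 2F; 3F; 4F; 5F; 6F)
open import Data.Sum using (inj₁; inj₂)
open import Function.Bundles using (_⇔_; mk⇔; Equivalence)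
open import Relation.Nullary using (contradiction)

*-pos : ∀ {i j} → i > 0ℤ → j > 0ℤ → i * j > 0ℤ
*-pos {+[1+ _ ]} {+[1+ _ ]} _ _ = +<+ (s≤s z≤n)
*-pos {+0} (+<+ ())
*-pos {+[1+ _ ]} {+0} _ (+<+ ())

>0⇒≢0 : ∀ {i} → i > 0ℤ → i ≢ 0ℤ
>0⇒≢0 (+<+ ()) refl

+≢0 : ∀ {n} → NonZero n → + n ≢ 0ℤ
+≢0 {suc n} _ ()

+>0 : ∀ {n} → NonZero n → + n > 0ℤ
+>0 {suc n} _ = +<+ (s≤s z≤n)

*-≢0 : ∀ {i j} → i ≢ 0ℤ → j ≢ 0ℤ → i * j ≢ 0ℤ
*-≢0 {i} i≢0 j≢0 ij≡0 with i*j≡0⇒i≡0∨j≡0 i ij≡0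
... | inj₁ i≡0 = i≢0 i≡0
... | inj₂ j≡0 = j≢0 j≡0

*-cancelˡ-≢0 : ∀ {c i j} → c ≢ 0ℤ → c * i ≡ c * j → i ≡ j
*-cancelˡ-≢0 {c} {i} {j} c≢0 = *-cancelˡ-≡ c i j {{≢-nonZero c≢0}}

*-cancelʳ-≢0 : ∀ {c i j} → c ≢ 0ℤ → i * c ≡ j * c → i ≡ j
*-cancelʳ-≢0 {c} {i} {j} c≢0 = *-cancelʳ-≡ i j c {{≢-nonZero c≢0}}

x+y≡0⇒x≡-y : ∀ {x y} → x + y ≡ 0ℤ → x ≡ - y
x+y≡0⇒x≡-y {x} {y} x+y≡0 = begin
  x             ≡⟨ solve (x ∷ y ∷ []) ⟩
  (x + y) + - y ≡⟨ cong (_+ - y) x+y≡0 ⟩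
  0ℤ + - y      ≡⟨ +-identityˡ (- y) ⟩
  - y           ∎
  where open ≡-Reasoning

n≡m*w⇒m∣n : ∀ m {n w} → n ≡ m * w → m ℤ.∣ n
n≡m*w⇒m∣n m {n} {w} n≡mw = ℤˢ.∣⇒∣ᵤ (ℤˢ.divides w (trans n≡mw (*-comm m w)))

gcd≡1⇒coprime-∣∣ : ∀ {a b} → gcd a b ≡ 1ℤ → Coprime ∣ a ∣ ∣ b ∣
gcd≡1⇒coprime-∣∣ {a} {b} gcd≡1 = gcd≡1⇒coprime {∣ a ∣} {∣ b ∣} (+-injective gcd≡1)

record LowestTerms (a b : ℤ) : Set where
  field
    num : ℤ
    den : ℕ
    den≢0 : NonZero den
    num*b≡den*a : num * b ≡ + den * a
    coprime : Coprime ∣ num ∣ den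

↥⊥↧ : (q : ℚ) → Coprime ∣ ↥ q ∣ (↧ₙ q)
↥⊥↧ (mkℚ _ _ c) = recompute c

lowestTerms⁺ : ∀ a n → LowestTerms a +[1+ n ]
lowestTerms⁺ a n = record
  { num = ↥ q ; den = ↧ₙ q ; den≢0 = _
  ; num*b≡den*a = begin
      ↥ q * +[1+ n ]    ≡⟨ cong (↥ q *_) (↧-/ a (suc n)) ⟨
      ↥ q * (↧ q * g)   ≡⟨ x∙yz≈y∙xz (↥ q) (↧ q) g ⟩
      ↧ q * (↥ q * g)   ≡⟨ cong (↧ q *_) (↥-/ a (suc n)) ⟩
      ↧ q * a           ∎
  ; coprime = ↥⊥↧ q
  }
  where
  open ≡-Reasoning
  q = a / suc n
  g = gcd a +[1+ n ]

lowestTerms : ∀ a b → b ≢ 0ℤ → LowestTerms a b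
lowestTerms a +0 b≢0 = contradiction refl b≢0
lowestTerms a +[1+ n ] _ = lowestTerms⁺ a n
lowestTerms a -[1+ n ] _ = record
  { num = num ; den = den ; den≢0 = den≢0 ; coprime = coprime
  ; num*b≡den*a = begin
      num * - +[1+ n ]     ≡⟨ neg-distribʳ-* num +[1+ n ] ⟨
      - (num * +[1+ n ])   ≡⟨ cong -_ num*b≡den*a ⟩
      - (+ den * - a)      ≡⟨ neg-distribʳ-* (+ den) (- a) ⟩
      + den * - - a        ≡⟨ cong (+ den *_) (neg-involutive a) ⟩
      + den * a            ∎
  }
  where
  open ≡-Reasoning
  open LowestTerms (lowestTerms⁺ (- a) n)

num≢0 : ∀ {a b} (L : LowestTerms a b) → a ≢ 0ℤ → LowestTerms.num L ≢ 0ℤ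
num≢0 {a} {b} L a≢0 num≡0 = *-≢0 (+≢0 den≢0) a≢0 (trans (sym num*b≡den*a) (cong (_* b) num≡0))
  where open LowestTerms L

cross-multiply : ∀ {a b c d X Y} → X ≢ 0ℤ → a * X ≡ b * Y → c * X ≡ d * Y → a * d ≡ c * b
cross-multiply {a} {b} {c} {d} {X} {Y} X≢0 aX≡bY cX≡dY = *-cancelˡ-≢0 X≢0 (begin
  X * (a * d)   ≡⟨ solve (X ∷ a ∷ d ∷ []) ⟩
  (a * X) * d   ≡⟨ cong (_* d) aX≡bY ⟩
  (b * Y) * d   ≡⟨ solve (b ∷ Y ∷ d ∷ []) ⟩
  b * (d * Y)   ≡⟨ cong (b *_) cX≡dY ⟨
  b * (c * X)   ≡⟨ solve (b ∷ c ∷ X ∷ []) ⟩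
  X * (c * b)   ∎)
  where open ≡-Reasoning

coprime-cross-unique : ∀ {a b c d} → gcd a b ≡ 1ℤ → gcd c d ≡ 1ℤ → b > 0ℤ → d > 0ℤ →
  a * d ≡ c * b → a ≡ c × b ≡ d
coprime-cross-unique {a} {+[1+ k ]} {c} {+[1+ l ]} gcd[a,b]≡1 gcd[c,d]≡1 _ _ ad≡cb =
  *-cancelʳ-≡ a c +[1+ l ] (trans ad≡cb (cong (λ n → c * + n) B≡D)) , cong +_ B≡D
  where
  B = suc k
  D = suc l
  ∣a∣D≡∣c∣B : ∣ a ∣ ℕ.* D ≡ ∣ c ∣ ℕ.* B
  ∣a∣D≡∣c∣B = trans (sym (abs-* a (+ D))) (trans (cong ∣_∣ ad≡cb) (abs-* c (+ B)))
  B∣D : B ∣ D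
  B∣D = coprime-divisor (⊥-sym (gcd≡1⇒coprime-∣∣ {a} {+ B} gcd[a,b]≡1)) (divides ∣ c ∣ ∣a∣D≡∣c∣B)
  D∣B : D ∣ B
  D∣B = coprime-divisor (⊥-sym (gcd≡1⇒coprime-∣∣ {c} {+ D} gcd[c,d]≡1)) (divides ∣ a ∣ (sym ∣a∣D≡∣c∣B))
  B≡D : B ≡ D
  B≡D = ∣-antisym B∣D D∣B
coprime-cross-unique {b = +0} _ _ (+<+ ())
coprime-cross-unique {b = +[1+ _ ]} {d = +0} _ _ _ (+<+ ())

lowestTerms-unique : ∀ {a b c d X Y} → gcd a b ≡ 1ℤ → gcd c d ≡ 1ℤ → b > 0ℤ → d > 0ℤ → X ≢ 0ℤ →
  a * X ≡ b * Y → c * X ≡ d * Y → a ≡ c × b ≡ d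
lowestTerms-unique {a} {b} {c} {d} a⊥b c⊥d b>0 d>0 X≢0 aX≡bY cX≡dY =
  coprime-cross-unique {a} {b} {c} {d} a⊥b c⊥d b>0 d>0 (cross-multiply {a} {b} {c} {d} X≢0 aX≡bY cX≡dY)

Proportional : Coords → Coords → Set
Proportional y x = ∀ i → y i * x 5F ≡ y 5F * x i

projEq⇒proportional : ∀ {y x} → ProjEq y x → Proportional y x
projEq⇒proportional {y} {x} (l , m , l≢0 , _ , ly≡mx) i = *-cancelˡ-≢0 l≢0 (begin
  l * (y i * x 5F)   ≡⟨ *-assoc l (y i) (x 5F) ⟨
  l * y i * x 5F     ≡⟨ cong (_* x 5F) (ly≡mx i) ⟩
  m * x i * x 5F     ≡⟨ xy∙z≈xz∙y m (x i) (x 5F) ⟩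
  m * x 5F * x i     ≡⟨ cong (_* x i) (ly≡mx 5F) ⟨
  l * y 5F * x i     ≡⟨ *-assoc l (y 5F) (x i) ⟩
  l * (y 5F * x i)   ∎)
  where open ≡-Reasoning

proportional⇒projEq : ∀ {y x} → y 5F ≢ 0ℤ → x 5F ≢ 0ℤ → Proportional y x → ProjEq y x
proportional⇒projEq {y} {x} y₅≢0 x₅≢0 y∝x =
  x 5F , y 5F , x₅≢0 , y₅≢0 , λ i → trans (*-comm (x 5F) (y i)) (y∝x i)

projEq-resp-≗ : ∀ {y z x} → y ≗ z → ProjEq y x → ProjEq z x
projEq-resp-≗ y≗z (l , m , l≢0 , m≢0 , ly≡mx) =
  l , m , l≢0 , m≢0 , λ i → trans (cong (l *_) (sym (y≗z i))) (ly≡mx i)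

Binomial : Coords → Set
Binomial x = (x 0F * x 5F ≡ x 3F * x 4F) × (x 1F * x 5F ≡ x 3F * x 6F) × (x 2F * x 5F ≡ x 4F * x 6F)

onS⇒binomial : ∀ x → OnS x → Binomial x
onS⇒binomial x (_ , _ , _ , _ , e₅ , e₆ , _ , e₈ , _) =
  sym (i-j≡0⇒i≡j _ _ e₈) , i-j≡0⇒i≡j _ _ e₆ , i-j≡0⇒i≡j _ _ e₅

onS⇒quadric : ∀ x → OnS x → x 3F * x 5F + x 4F * x 5F + x 6F * x 6F ≡ 0ℤ
onS⇒quadric x (_ , _ , _ , e₄ , _) = e₄

-- (yⱼx₅)(yₖx₅) = (y₅xⱼ)(y₅xₖ) turns x₅² yᵢy₅ into y₅² xᵢx₅.
binomial-propagates : ∀ {yᵢ yⱼ yₖ y₅ xᵢ xⱼ xₖ x₅} → y₅ ≢ 0ℤ → x₅ ≢ 0ℤ →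
  yᵢ * y₅ ≡ yⱼ * yₖ → xᵢ * x₅ ≡ xⱼ * xₖ →
  yⱼ * x₅ ≡ y₅ * xⱼ → yₖ * x₅ ≡ y₅ * xₖ → yᵢ * x₅ ≡ y₅ * xᵢ
binomial-propagates {yᵢ} {yⱼ} {yₖ} {y₅} {xᵢ} {xⱼ} {xₖ} {x₅} y₅≢0 x₅≢0 yᵢy₅ xᵢx₅ yⱼ∝xⱼ yₖ∝xₖ =
  *-cancelˡ-≢0 (*-≢0 y₅≢0 x₅≢0) (begin
    y₅ * x₅ * (yᵢ * x₅)     ≡⟨ solve (y₅ ∷ x₅ ∷ yᵢ ∷ []) ⟩
    yᵢ * y₅ * (x₅ * x₅)     ≡⟨ cong (_* (x₅ * x₅)) yᵢy₅ ⟩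
    yⱼ * yₖ * (x₅ * x₅)     ≡⟨ solve (yⱼ ∷ yₖ ∷ x₅ ∷ []) ⟩
    (yⱼ * x₅) * (yₖ * x₅)   ≡⟨ cong₂ _*_ yⱼ∝xⱼ yₖ∝xₖ ⟩
    (y₅ * xⱼ) * (y₅ * xₖ)   ≡⟨ solve (y₅ ∷ xⱼ ∷ xₖ ∷ []) ⟩
    y₅ * y₅ * (xⱼ * xₖ)     ≡⟨ cong (y₅ * y₅ *_) xᵢx₅ ⟨
    y₅ * y₅ * (xᵢ * x₅)     ≡⟨ solve (y₅ ∷ xᵢ ∷ x₅ ∷ []) ⟩
    y₅ * x₅ * (y₅ * xᵢ)     ∎)
  where open ≡-Reasoning

binomial⇒proportional : ∀ {y x} → y 5F ≢ 0ℤ → x 5F ≢ 0ℤ → Binomial y → Binomial x →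
  y 3F * x 5F ≡ y 5F * x 3F → y 4F * x 5F ≡ y 5F * x 4F → y 6F * x 5F ≡ y 5F * x 6F →
  Proportional y x
binomial⇒proportional {y} {x} y₅≢0 x₅≢0 (y₀ , y₁ , y₂) (x₀ , x₁ , x₂) y₃∝x₃ y₄∝x₄ y₆∝x₆ = y∝x
  where
  propagate : ∀ {i j k} → y i * y 5F ≡ y j * y k → x i * x 5F ≡ x j * x k →
    y j * x 5F ≡ y 5F * x j → y k * x 5F ≡ y 5F * x k → y i * x 5F ≡ y 5F * x i
  propagate {i} {j} {k} = binomial-propagates {y i} {y j} {y k} {y 5F} {x i} {x j} {x k} {x 5F} y₅≢0 x₅≢0
  y∝x : Proportional y x
  y∝x 0F = propagate y₀ x₀ y₃∝x₃ y₄∝x₄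
  y∝x 1F = propagate y₁ x₁ y₃∝x₃ y₆∝x₆
  y∝x 2F = propagate y₂ x₂ y₄∝x₄ y₆∝x₆
  y∝x 3F = y₃∝x₃
  y∝x 4F = y₄∝x₄
  y∝x 5F = refl
  y∝x 6F = y₆∝x₆

d₁ d₂ d₃ : Tor → ℤ
d₁ t = e1 t * e3 t * e4 t
d₂ t = e1 t * e2 t * e4 t
d₃ t = e1 t * e2 t * e3 t

PositiveWeights : Tor → Set
PositiveWeights t = (e1 t > 0ℤ) × (e2 t > 0ℤ) × (e3 t > 0ℤ) × (e4 t > 0ℤ)

d₁>0 : ∀ t → PositiveWeights t → d₁ t > 0ℤ
d₁>0 t (η₁>0 , _ , η₃>0 , η₄>0) = *-pos (*-pos η₁>0 η₃>0) η₄>0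

d₂>0 : ∀ t → PositiveWeights t → d₂ t > 0ℤ
d₂>0 t (η₁>0 , η₂>0 , _ , η₄>0) = *-pos (*-pos η₁>0 η₂>0) η₄>0

d₃>0 : ∀ t → PositiveWeights t → d₃ t > 0ℤ
d₃>0 t (η₁>0 , η₂>0 , η₃>0 , _) = *-pos (*-pos η₁>0 η₂>0) η₃>0

πᵈ : Tor → Coords
πᵈ t = mk (α₂ * α₃) (d₃ t * α₁ * α₂) (d₂ t * α₁ * α₃) (d₁ t * d₃ t * α₂) (d₁ t * d₂ t * α₃)
          (d₁ t * d₂ t * d₃ t * d₁ t) (d₁ t * d₂ t * d₃ t * α₁)
  where
  α₁ = a1 t
  α₂ = a2 t
  α₃ = a3 t

π≗πᵈ : ∀ t → π t ≗ πᵈ t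
π≗πᵈ (tor α₁ α₂ α₃ η₁ η₂ η₃ η₄) 0F = refl
π≗πᵈ (tor α₁ α₂ α₃ η₁ η₂ η₃ η₄) 1F = refl
π≗πᵈ (tor α₁ α₂ α₃ η₁ η₂ η₃ η₄) 2F = refl
π≗πᵈ (tor α₁ α₂ α₃ η₁ η₂ η₃ η₄) 3F = π₃ α₂ η₁ η₂ η₃ η₄
  where
  π₃ : ∀ α₂ η₁ η₂ η₃ η₄ → η₁ * η₁ * η₂ * η₃ * η₃ * η₄ * α₂ ≡ η₁ * η₃ * η₄ * (η₁ * η₂ * η₃) * α₂
  π₃ = solve-∀
π≗πᵈ (tor α₁ α₂ α₃ η₁ η₂ η₃ η₄) 4F = π₄ α₃ η₁ η₂ η₃ η₄
  where
  π₄ : ∀ α₃ η₁ η₂ η₃ η₄ → η₁ * η₁ * η₂ * η₃ * η₄ * η₄ * α₃ ≡ η₁ * η₃ * η₄ * (η₁ * η₂ * η₄) * α₃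
  π₄ = solve-∀
π≗πᵈ (tor α₁ α₂ α₃ η₁ η₂ η₃ η₄) 5F = π₅ η₁ η₂ η₃ η₄
  where
  π₅ : ∀ η₁ η₂ η₃ η₄ → η₁ * η₁ * η₁ * η₁ * η₂ * η₂ * η₃ * η₃ * η₃ * η₄ * η₄ * η₄
                      ≡ η₁ * η₃ * η₄ * (η₁ * η₂ * η₄) * (η₁ * η₂ * η₃) * (η₁ * η₃ * η₄)
  π₅ = solve-∀
π≗πᵈ (tor α₁ α₂ α₃ η₁ η₂ η₃ η₄) 6F = π₆ α₁ η₁ η₂ η₃ η₄
  where
  π₆ : ∀ α₁ η₁ η₂ η₃ η₄ → η₁ * η₁ * η₁ * η₂ * η₂ * η₃ * η₃ * η₄ * η₄ * α₁
                         ≡ η₁ * η₃ * η₄ * (η₁ * η₂ * η₄) * (η₁ * η₂ * η₃) * α₁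
  π₆ = solve-∀

πᵈ-binomial : ∀ t → Binomial (πᵈ t)
πᵈ-binomial t = binomialᵈ (a1 t) (a2 t) (a3 t) (d₁ t) (d₂ t) (d₃ t)
  where
  binomialᵈ : ∀ α₁ α₂ α₃ D₁ D₂ D₃ →
    (α₂ * α₃) * (D₁ * D₂ * D₃ * D₁) ≡ (D₁ * D₃ * α₂) * (D₁ * D₂ * α₃) ×
    (D₃ * α₁ * α₂) * (D₁ * D₂ * D₃ * D₁) ≡ (D₁ * D₃ * α₂) * (D₁ * D₂ * D₃ * α₁) ×
    (D₂ * α₁ * α₃) * (D₁ * D₂ * D₃ * D₁) ≡ (D₁ * D₂ * α₃) * (D₁ * D₂ * D₃ * α₁)
  binomialᵈ α₁ α₂ α₃ D₁ D₂ D₃ =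
    solve (α₁ ∷ α₂ ∷ α₃ ∷ D₁ ∷ D₂ ∷ D₃ ∷ []) ,
    solve (α₁ ∷ α₂ ∷ α₃ ∷ D₁ ∷ D₂ ∷ D₃ ∷ []) ,
    solve (α₁ ∷ α₂ ∷ α₃ ∷ D₁ ∷ D₂ ∷ D₃ ∷ [])

Fractions : Coords → Tor → Set
Fractions x t =
  (a1 t * x 5F ≡ d₁ t * x 6F) × (a2 t * x 5F ≡ d₂ t * (d₁ t * x 3F)) × (a3 t * x 5F ≡ d₃ t * (d₁ t * x 4F))

scaled-⇔ : ∀ {c P Q L R} → c ≢ 0ℤ → P ≡ c * L → Q ≡ c * R → (P ≡ Q) ⇔ (L ≡ R)
scaled-⇔ {c} c≢0 P≡cL Q≡cR = mk⇔
  (λ P≡Q → *-cancelˡ-≢0 c≢0 (trans (sym P≡cL) (trans P≡Q Q≡cR)))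
  (λ L≡R → trans P≡cL (trans (cong (c *_) L≡R) (sym Q≡cR)))

coordinates⇔fractions : ∀ α₁ α₂ α₃ D₁ D₂ D₃ X₃ X₄ X₅ X₆ → D₁ ≢ 0ℤ → D₂ ≢ 0ℤ → D₃ ≢ 0ℤ →
  (D₁ * D₂ * D₃ * α₁ * X₅ ≡ D₁ * D₂ * D₃ * D₁ * X₆ ⇔ α₁ * X₅ ≡ D₁ * X₆) ×
  (D₁ * D₃ * α₂ * X₅ ≡ D₁ * D₂ * D₃ * D₁ * X₃ ⇔ α₂ * X₅ ≡ D₂ * (D₁ * X₃)) ×
  (D₁ * D₂ * α₃ * X₅ ≡ D₁ * D₂ * D₃ * D₁ * X₄ ⇔ α₃ * X₅ ≡ D₃ * (D₁ * X₄))
coordinates⇔fractions α₁ α₂ α₃ D₁ D₂ D₃ X₃ X₄ X₅ X₆ D₁≢0 D₂≢0 D₃≢0 =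
  scaled-⇔ (*-≢0 (*-≢0 D₁≢0 D₂≢0) D₃≢0) (*-assoc (D₁ * D₂ * D₃) α₁ X₅) (*-assoc (D₁ * D₂ * D₃) D₁ X₆) ,
  scaled-⇔ (*-≢0 D₁≢0 D₃≢0) (*-assoc (D₁ * D₃) α₂ X₅) regroup₃ ,
  scaled-⇔ (*-≢0 D₁≢0 D₂≢0) (*-assoc (D₁ * D₂) α₃ X₅) regroup₄
  where
  regroup₃ : D₁ * D₂ * D₃ * D₁ * X₃ ≡ D₁ * D₃ * (D₂ * (D₁ * X₃))
  regroup₃ = solve (D₁ ∷ D₂ ∷ D₃ ∷ X₃ ∷ [])
  regroup₄ : D₁ * D₂ * D₃ * D₁ * X₄ ≡ D₁ * D₂ * (D₃ * (D₁ * X₄))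
  regroup₄ = solve (D₁ ∷ D₂ ∷ D₃ ∷ X₄ ∷ [])

projEq⇔fractions : ∀ x t → PositiveWeights t → x 5F ≢ 0ℤ → Binomial x → ProjEq (π t) x ⇔ Fractions x t
projEq⇔fractions x t η>0 x₅≢0 x-binomial = mk⇔
  (λ π∼x → let πᵈ∝x = projEq⇒proportional (projEq-resp-≗ (π≗πᵈ t) π∼x) in
    to c₆ (πᵈ∝x 6F) , to c₃ (πᵈ∝x 3F) , to c₄ (πᵈ∝x 4F))
  (λ (f₁ , f₂ , f₃) → projEq-resp-≗ (λ i → sym (π≗πᵈ t i)) (proportional⇒projEq πᵈ₅≢0 x₅≢0
    (binomial⇒proportional {πᵈ t} πᵈ₅≢0 x₅≢0 (πᵈ-binomial t) x-binomial (from c₃ f₂) (from c₄ f₃) (from c₆ f₁))))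
  where
  open Equivalence
  d₁≢0 = >0⇒≢0 (d₁>0 t η>0)
  d₂≢0 = >0⇒≢0 (d₂>0 t η>0)
  d₃≢0 = >0⇒≢0 (d₃>0 t η>0)
  πᵈ₅≢0 : πᵈ t 5F ≢ 0ℤ
  πᵈ₅≢0 = *-≢0 (*-≢0 (*-≢0 d₁≢0 d₂≢0) d₃≢0) d₁≢0
  cs = coordinates⇔fractions (a1 t) (a2 t) (a3 t) (d₁ t) (d₂ t) (d₃ t) (x 3F) (x 4F) (x 5F) (x 6F) d₁≢0 d₂≢0 d₃≢0
  c₆ = proj₁ cs
  c₃ = proj₁ (proj₂ cs)
  c₄ = proj₂ (proj₂ cs)

-- The torsor equation multiplied by η₁²η₂η₃η₄, with (p, q, r) = (d₁, d₂, d₃).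
form : ℤ → ℤ → ℤ → ℤ → ℤ → ℤ → ℤ
form α₁ α₂ α₃ p q r = α₁ * α₁ * (q * r) + α₂ * (p * r) + α₃ * (p * q)

fractions⇒form≡0 : ∀ α₁ α₂ α₃ p q r X₃ X₄ X₅ X₆ → X₅ ≢ 0ℤ →
  α₁ * X₅ ≡ p * X₆ → α₂ * X₅ ≡ q * (p * X₃) → α₃ * X₅ ≡ r * (p * X₄) →
  X₃ * X₅ + X₄ * X₅ + X₆ * X₆ ≡ 0ℤ → form α₁ α₂ α₃ p q r ≡ 0ℤ
fractions⇒form≡0 α₁ α₂ α₃ p q r X₃ X₄ X₅ X₆ X₅≢0 f₁ f₂ f₃ quadric = *-cancelˡ-≢0 (*-≢0 X₅≢0 X₅≢0) (begin
  X₅ * X₅ * (α₁ * α₁ * (q * r) + α₂ * (p * r) + α₃ * (p * q))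
    ≡⟨ solve (α₁ ∷ α₂ ∷ α₃ ∷ p ∷ q ∷ r ∷ X₅ ∷ []) ⟩
  (α₁ * X₅) * (α₁ * X₅) * (q * r) + (α₂ * X₅) * X₅ * (p * r) + (α₃ * X₅) * X₅ * (p * q)
    ≡⟨ cong₂ (λ A B → A * A * (q * r) + B * X₅ * (p * r) + (α₃ * X₅) * X₅ * (p * q)) f₁ f₂ ⟩
  (p * X₆) * (p * X₆) * (q * r) + (q * (p * X₃)) * X₅ * (p * r) + (α₃ * X₅) * X₅ * (p * q)
    ≡⟨ cong (λ C → (p * X₆) * (p * X₆) * (q * r) + (q * (p * X₃)) * X₅ * (p * r) + C * X₅ * (p * q)) f₃ ⟩
  (p * X₆) * (p * X₆) * (q * r) + (q * (p * X₃)) * X₅ * (p * r) + (r * (p * X₄)) * X₅ * (p * q)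
    ≡⟨ solve (p ∷ q ∷ r ∷ X₃ ∷ X₄ ∷ X₅ ∷ X₆ ∷ []) ⟩
  p * p * q * r * (X₃ * X₅ + X₄ * X₅ + X₆ * X₆)
    ≡⟨ cong (p * p * q * r *_) quadric ⟩
  p * p * q * r * 0ℤ
    ≡⟨ solve (p ∷ q ∷ r ∷ X₅ ∷ []) ⟩
  X₅ * X₅ * 0ℤ ∎)
  where open ≡-Reasoning

form≡0-cancelFactor : ∀ α₁ α₂ α₃ {D₁ D₂ D₃} a b c g → NonZero g →
  D₁ ≡ a ℕ.* g → D₂ ≡ b ℕ.* g → D₃ ≡ c ℕ.* g →
  form α₁ α₂ α₃ (+ D₁) (+ D₂) (+ D₃) ≡ 0ℤ → form α₁ α₂ α₃ (+ a) (+ b) (+ c) ≡ 0ℤ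
form≡0-cancelFactor α₁ α₂ α₃ a b c g g≢0 refl refl refl form≡0 =
  *-cancelˡ-≢0 (*-≢0 (+≢0 g≢0) (+≢0 g≢0))
    (trans (sym homogeneous⁺) (trans form≡0 (sym (*-zeroʳ (+ g * + g)))))
  where
  homogeneous : ∀ α₁ α₂ α₃ p q r g → form α₁ α₂ α₃ (p * g) (q * g) (r * g) ≡ g * g * form α₁ α₂ α₃ p q r
  homogeneous α₁ α₂ α₃ p q r g = begin
    α₁ * α₁ * (q * g * (r * g)) + α₂ * (p * g * (r * g)) + α₃ * (p * g * (q * g))
      ≡⟨ solve (α₁ ∷ α₂ ∷ α₃ ∷ p ∷ q ∷ r ∷ g ∷ []) ⟩
    g * g * (α₁ * α₁ * (q * r) + α₂ * (p * r) + α₃ * (p * q)) ∎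
    where open ≡-Reasoning
  homogeneous⁺ : form α₁ α₂ α₃ (+ (a ℕ.* g)) (+ (b ℕ.* g)) (+ (c ℕ.* g))
               ≡ + g * + g * form α₁ α₂ α₃ (+ a) (+ b) (+ c)
  homogeneous⁺ = begin
    form α₁ α₂ α₃ (+ (a ℕ.* g)) (+ (b ℕ.* g)) (+ (c ℕ.* g))
      ≡⟨ cong₂ (λ p q → form α₁ α₂ α₃ p q (+ (c ℕ.* g))) (pos-* a g) (pos-* b g) ⟩
    form α₁ α₂ α₃ (+ a * + g) (+ b * + g) (+ (c ℕ.* g))
      ≡⟨ cong (form α₁ α₂ α₃ (+ a * + g) (+ b * + g)) (pos-* c g) ⟩
    form α₁ α₂ α₃ (+ a * + g) (+ b * + g) (+ c * + g)
      ≡⟨ homogeneous α₁ α₂ α₃ (+ a) (+ b) (+ c) (+ g) ⟩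
    + g * + g * form α₁ α₂ α₃ (+ a) (+ b) (+ c) ∎
    where open ≡-Reasoning

form≡0⇒torEq : ∀ α₁ α₂ α₃ {a b c} u v w → NonZero u → NonZero v → NonZero w →
  a ≡ v ℕ.* w → b ≡ u ℕ.* w → c ≡ u ℕ.* v →
  form α₁ α₂ α₃ (+ a) (+ b) (+ c) ≡ 0ℤ → + u * (α₁ * α₁) + + v * α₂ + + w * α₃ ≡ 0ℤ
form≡0⇒torEq α₁ α₂ α₃ u v w u≢0 v≢0 w≢0 refl refl refl form≡0 =
  *-cancelˡ-≢0 (*-≢0 (*-≢0 (+≢0 u≢0) (+≢0 v≢0)) (+≢0 w≢0))
    (trans (sym factorised⁺) (trans form≡0 (sym (*-zeroʳ (+ u * + v * + w)))))
  where
  factorised : ∀ α₁ α₂ α₃ u v w →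
    form α₁ α₂ α₃ (v * w) (u * w) (u * v) ≡ u * v * w * (u * (α₁ * α₁) + v * α₂ + w * α₃)
  factorised α₁ α₂ α₃ u v w = begin
    α₁ * α₁ * (u * w * (u * v)) + α₂ * (v * w * (u * v)) + α₃ * (v * w * (u * w))
      ≡⟨ solve (α₁ ∷ α₂ ∷ α₃ ∷ u ∷ v ∷ w ∷ []) ⟩
    u * v * w * (u * (α₁ * α₁) + v * α₂ + w * α₃) ∎
    where open ≡-Reasoning
  factorised⁺ : form α₁ α₂ α₃ (+ (v ℕ.* w)) (+ (u ℕ.* w)) (+ (u ℕ.* v))
       ≡ + u * + v * + w * (+ u * (α₁ * α₁) + + v * α₂ + + w * α₃)
  factorised⁺ = begin
    form α₁ α₂ α₃ (+ (v ℕ.* w)) (+ (u ℕ.* w)) (+ (u ℕ.* v))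
      ≡⟨ cong₂ (λ p q → form α₁ α₂ α₃ p q (+ (u ℕ.* v))) (pos-* v w) (pos-* u w) ⟩
    form α₁ α₂ α₃ (+ v * + w) (+ u * + w) (+ (u ℕ.* v))
      ≡⟨ cong (form α₁ α₂ α₃ (+ v * + w) (+ u * + w)) (pos-* u v) ⟩
    form α₁ α₂ α₃ (+ v * + w) (+ u * + w) (+ u * + v)
      ≡⟨ factorised α₁ α₂ α₃ (+ u) (+ v) (+ w) ⟩
    + u * + v * + w * (+ u * (α₁ * α₁) + + v * α₂ + + w * α₃) ∎
    where open ≡-Reasoning

-- Modulo a only the term α₁²bc survives, and α₁ is prime to a; likewise for b and c.
form≡0⇒mutuallyDividing : ∀ α₁ α₂ α₃ a b c →
  Coprime ∣ α₁ ∣ a → Coprime ∣ α₂ ∣ b → Coprime ∣ α₃ ∣ c → form α₁ α₂ α₃ (+ a) (+ b) (+ c) ≡ 0ℤ →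
  MutuallyDividing a b c
form≡0⇒mutuallyDividing α₁ α₂ α₃ a b c α₁⊥a α₂⊥b α₃⊥c form≡0 =
  subst (a ∣_) (abs-* Q R) (cancel α₁ α₁⊥a (Q * R) (cancel α₁ α₁⊥a (α₁ * (Q * R)) (n≡m*w⇒m∣n P isolate₁))) ,
  subst (b ∣_) (abs-* P R) (cancel α₂ α₂⊥b (P * R) (n≡m*w⇒m∣n Q isolate₂)) ,
  subst (c ∣_) (abs-* P Q) (cancel α₃ α₃⊥c (P * Q) (n≡m*w⇒m∣n R isolate₃))
  where
  P = + a
  Q = + b
  R = + c
  cancel : ∀ γ {m} → Coprime ∣ γ ∣ m → ∀ k → + m ℤ.∣ γ * k → + m ℤ.∣ k
  cancel γ {m} γ⊥m k = ℤ.coprime-divisor (+ m) γ k (⊥-sym γ⊥m)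
  isolate : ∀ {x} p y → form α₁ α₂ α₃ P Q R ≡ x + p * y → x ≡ p * - y
  isolate p y form≡x+py = trans (x+y≡0⇒x≡-y (trans (sym form≡x+py) form≡0)) (neg-distribʳ-* p y)
  regroup₁ : ∀ α₁ α₂ α₃ p q r →
    α₁ * α₁ * (q * r) + α₂ * (p * r) + α₃ * (p * q) ≡ α₁ * (α₁ * (q * r)) + p * (α₂ * r + α₃ * q)
  regroup₁ = solve-∀
  regroup₂ : ∀ α₁ α₂ α₃ p q r →
    α₁ * α₁ * (q * r) + α₂ * (p * r) + α₃ * (p * q) ≡ α₂ * (p * r) + q * (α₁ * α₁ * r + α₃ * p)
  regroup₂ = solve-∀
  regroup₃ : ∀ α₁ α₂ α₃ p q r →
    α₁ * α₁ * (q * r) + α₂ * (p * r) + α₃ * (p * q) ≡ α₃ * (p * q) + r * (α₁ * α₁ * q + α₂ * p)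
  regroup₃ = solve-∀
  isolate₁ : α₁ * (α₁ * (Q * R)) ≡ P * - (α₂ * R + α₃ * Q)
  isolate₁ = isolate P (α₂ * R + α₃ * Q) (regroup₁ α₁ α₂ α₃ P Q R)
  isolate₂ : α₂ * (P * R) ≡ Q * - (α₁ * α₁ * R + α₃ * P)
  isolate₂ = isolate Q (α₁ * α₁ * R + α₃ * P) (regroup₂ α₁ α₂ α₃ P Q R)
  isolate₃ : α₃ * (P * Q) ≡ R * - (α₁ * α₁ * Q + α₂ * P)
  isolate₃ = isolate R (α₁ * α₁ * Q + α₂ * P) (regroup₃ α₁ α₂ α₃ P Q R)

pos-*³ : ∀ g v w → + g * + v * + w ≡ + (v ℕ.* w ℕ.* g)
pos-*³ g v w = begin
  + g * + v * + w     ≡⟨ *-assoc (+ g) (+ v) (+ w) ⟩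
  + g * (+ v * + w)   ≡⟨ *-comm (+ g) (+ v * + w) ⟩
  + v * + w * + g     ≡⟨ cong (_* + g) (pos-* v w) ⟨
  + (v ℕ.* w) * + g   ≡⟨ pos-* (v ℕ.* w) g ⟨
  + (v ℕ.* w ℕ.* g)   ∎
  where open ≡-Reasoning

record TorsorLift (α₁ α₂ α₃ : ℤ) (D₁ D₂ D₃ : ℕ) : Set where
  field
    η₁ η₂ η₃ η₄ : ℤ
  point : Tor
  point = tor α₁ α₂ α₃ η₁ η₂ η₃ η₄
  field
    d₁≡D₁ : d₁ point ≡ + D₁
    d₂≡D₂ : d₂ point ≡ + D₂
    d₃≡D₃ : d₃ point ≡ + D₃
    torEq : TorEq point
    η₁>0 : η₁ > 0ℤ
    η₂>0 : η₂ > 0ℤ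
    η₃>0 : η₃ > 0ℤ
    η₄>0 : η₄ > 0ℤ
    η₂⊥η₃ : gcd η₂ η₃ ≡ 1ℤ
    η₂⊥η₄ : gcd η₂ η₄ ≡ 1ℤ
    η₃⊥η₄ : gcd η₃ η₄ ≡ 1ℤ

-- η₁ is the common factor of D₁, D₂, D₃ and (η₂, η₃, η₄) the pairwise coprime factors of what remains.
torsorLift : ∀ α₁ α₂ α₃ D₁ D₂ D₃ → NonZero D₁ → NonZero D₂ → NonZero D₃ →
  Coprime ∣ α₁ ∣ D₁ → Coprime ∣ α₂ ∣ D₂ → Coprime ∣ α₃ ∣ D₃ →
  form α₁ α₂ α₃ (+ D₁) (+ D₂) (+ D₃) ≡ 0ℤ → TorsorLift α₁ α₂ α₃ D₁ D₂ D₃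
torsorLift α₁ α₂ α₃ D₁ D₂ D₃ D₁≢0 D₂≢0 D₃≢0 α₁⊥D₁ α₂⊥D₂ α₃⊥D₃ form≡0 = record
  { η₁ = + g ; η₂ = + u ; η₃ = + v ; η₄ = + w
  ; d₁≡D₁ = trans (pos-*³ g v w) (cong +_ (sym (trans a≡a′*g (cong (ℕ._* g) a≡v*w))))
  ; d₂≡D₂ = trans (pos-*³ g u w) (cong +_ (sym (trans b≡b′*g (cong (ℕ._* g) b≡u*w))))
  ; d₃≡D₃ = trans (pos-*³ g u v) (cong +_ (sym (trans c≡c′*g (cong (ℕ._* g) c≡u*v))))
  ; torEq = form≡0⇒torEq α₁ α₂ α₃ u v w u≢0 v≢0 w≢0 a≡v*w b≡u*w c≡u*v form′≡0
  ; η₁>0 = +>0 g≢0 ; η₂>0 = +>0 u≢0 ; η₃>0 = +>0 v≢0 ; η₄>0 = +>0 w≢0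
  ; η₂⊥η₃ = cong +_ (coprime⇒gcd≡1 u⊥v)
  ; η₂⊥η₄ = cong +_ (coprime⇒gcd≡1 u⊥w)
  ; η₃⊥η₄ = cong +_ (coprime⇒gcd≡1 v⊥w)
  }
  where
  open CommonFactorSplit (splitCommonFactor D₁ D₂ D₃ {{D₁≢0}})
  a′≢0 = proj₁ (≡*⇒nonZero a′ g D₁≢0 a≡a′*g)
  b′≢0 = proj₁ (≡*⇒nonZero b′ g D₂≢0 b≡b′*g)
  c′≢0 = proj₁ (≡*⇒nonZero c′ g D₃≢0 c≡c′*g)
  form′≡0 : form α₁ α₂ α₃ (+ a′) (+ b′) (+ c′) ≡ 0ℤ
  form′≡0 = form≡0-cancelFactor α₁ α₂ α₃ a′ b′ c′ g g≢0 a≡a′*g b≡b′*g c≡c′*g form≡0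
  mutuallyDividing : MutuallyDividing a′ b′ c′
  mutuallyDividing = form≡0⇒mutuallyDividing α₁ α₂ α₃ a′ b′ c′
    (coprime-∣ʳ α₁⊥D₁ (≡*⇒∣ a′ g a≡a′*g)) (coprime-∣ʳ α₂⊥D₂ (≡*⇒∣ b′ g b≡b′*g))
    (coprime-∣ʳ α₃⊥D₃ (≡*⇒∣ c′ g c≡c′*g)) form′≡0
  open PairwiseCoprimeFactorisation
    (mutuallyDividing⇒factorisation a′ b′ c′ {{a′≢0}} {{b′≢0}} {{c′≢0}} coprime₃ mutuallyDividing)
  v≢0 = proj₁ (≡*⇒nonZero v w a′≢0 a≡v*w)
  w≢0 = proj₂ (≡*⇒nonZero v w a′≢0 a≡v*w)
  u≢0 = proj₁ (≡*⇒nonZero u w b′≢0 b≡u*w)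

existence : ∀ x → OnS x → AllNonzero x → Σ Tor (Good x)
existence x onS x≢0 = point , torEq , projEq , conds
  where
  x₅≢0 = x≢0 5F
  L₁ = lowestTerms (x 6F) (x 5F) x₅≢0
  open LowestTerms L₁ using () renaming (num to α₁; den to D₁; den≢0 to D₁≢0; num*b≡den*a to f₁; coprime to α₁⊥D₁)
  L₂ = lowestTerms (+ D₁ * x 3F) (x 5F) x₅≢0
  L₃ = lowestTerms (+ D₁ * x 4F) (x 5F) x₅≢0
  open LowestTerms L₂ using () renaming (num to α₂; den to D₂; den≢0 to D₂≢0; num*b≡den*a to f₂; coprime to α₂⊥D₂)
  open LowestTerms L₃ using () renaming (num to α₃; den to D₃; den≢0 to D₃≢0; num*b≡den*a to f₃; coprime to α₃⊥D₃)
  open TorsorLift (torsorLift α₁ α₂ α₃ D₁ D₂ D₃ D₁≢0 D₂≢0 D₃≢0 α₁⊥D₁ α₂⊥D₂ α₃⊥D₃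
    (fractions⇒form≡0 α₁ α₂ α₃ (+ D₁) (+ D₂) (+ D₃) (x 3F) (x 4F) (x 5F) (x 6F) x₅≢0 f₁ f₂ f₃ (onS⇒quadric x onS)))
  fractions : Fractions x point
  fractions = subst (λ d → α₁ * x 5F ≡ d * x 6F) (sym d₁≡D₁) f₁ ,
              subst₂ (λ d d′ → α₂ * x 5F ≡ d * (d′ * x 3F)) (sym d₂≡D₂) (sym d₁≡D₁) f₂ ,
              subst₂ (λ d d′ → α₃ * x 5F ≡ d * (d′ * x 4F)) (sym d₃≡D₃) (sym d₁≡D₁) f₃
  projEq : ProjEq (π point) x
  projEq = Equivalence.from
    (projEq⇔fractions x point (η₁>0 , η₂>0 , η₃>0 , η₄>0) x₅≢0 (onS⇒binomial x onS)) fractions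
  lowest : ∀ α {D} d → d ≡ + D → Coprime ∣ α ∣ D → gcd α d ≡ 1ℤ
  lowest α d refl α⊥D = cong +_ (coprime⇒gcd≡1 α⊥D)
  α₁α₂α₃≢0 : α₁ * α₂ * α₃ ≢ 0ℤ
  α₁α₂α₃≢0 = *-≢0 (*-≢0 (num≢0 L₁ (x≢0 6F)) (num≢0 L₂ (*-≢0 (+≢0 D₁≢0) (x≢0 3F))))
                  (num≢0 L₃ (*-≢0 (+≢0 D₁≢0) (x≢0 4F)))
  conds : Conds point
  conds = lowest α₁ (d₁ point) d₁≡D₁ α₁⊥D₁ , lowest α₂ (d₂ point) d₂≡D₂ α₂⊥D₂ ,
          lowest α₃ (d₃ point) d₃≡D₃ α₃⊥D₃ , η₂⊥η₃ , η₂⊥η₄ , η₃⊥η₄ , η₁>0 , η₂>0 , η₃>0 , η₄>0 , α₁α₂α₃≢0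

tor-cong : ∀ {α₁ α₂ α₃ η₁ η₂ η₃ η₄ β₁ β₂ β₃ κ₁ κ₂ κ₃ κ₄} →
  α₁ ≡ β₁ → α₂ ≡ β₂ → α₃ ≡ β₃ → η₁ ≡ κ₁ → η₂ ≡ κ₂ → η₃ ≡ κ₃ → η₄ ≡ κ₄ →
  tor α₁ α₂ α₃ η₁ η₂ η₃ η₄ ≡ tor β₁ β₂ β₃ κ₁ κ₂ κ₃ κ₄
tor-cong refl refl refl refl refl refl refl = refl

-- η₂/η₄ = d₃/d₁ and η₃/η₄ = d₃/d₂ are fractions in lowest terms.
weights-unique : ∀ s t → PositiveWeights s → PositiveWeights t →
  gcd (e2 s) (e4 s) ≡ 1ℤ → gcd (e3 s) (e4 s) ≡ 1ℤ → gcd (e2 t) (e4 t) ≡ 1ℤ → gcd (e3 t) (e4 t) ≡ 1ℤ →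
  d₁ s ≡ d₁ t → d₂ s ≡ d₂ t → d₃ s ≡ d₃ t → e1 s ≡ e1 t × e2 s ≡ e2 t × e3 s ≡ e3 t × e4 s ≡ e4 t
weights-unique s@(tor _ _ _ η₁ η₂ η₃ η₄) (tor _ _ _ κ₁ κ₂ κ₃ κ₄) s>0@(_ , _ , η₃>0 , η₄>0) (_ , _ , _ , κ₄>0)
  η₂⊥η₄ η₃⊥η₄ κ₂⊥κ₄ κ₃⊥κ₄ d₁≡ d₂≡ d₃≡ = η₁≡κ₁ , proj₁ η₂₄≡κ₂₄ , η₃≡κ₃ , proj₂ η₂₄≡κ₂₄
  where
  ratio₂ : ∀ η₁ η₂ η₃ η₄ → η₂ * (η₁ * η₃ * η₄) ≡ η₄ * (η₁ * η₂ * η₃)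
  ratio₂ η₁ η₂ η₃ η₄ = solve (η₁ ∷ η₂ ∷ η₃ ∷ η₄ ∷ [])
  ratio₃ : ∀ η₁ η₂ η₃ η₄ → η₃ * (η₁ * η₂ * η₄) ≡ η₄ * (η₁ * η₂ * η₃)
  ratio₃ η₁ η₂ η₃ η₄ = solve (η₁ ∷ η₂ ∷ η₃ ∷ η₄ ∷ [])
  η₂₄≡κ₂₄ : η₂ ≡ κ₂ × η₄ ≡ κ₄
  η₂₄≡κ₂₄ = lowestTerms-unique η₂⊥η₄ κ₂⊥κ₄ η₄>0 κ₄>0 (>0⇒≢0 (d₁>0 s s>0)) (ratio₂ η₁ η₂ η₃ η₄)
    (subst₂ (λ d d′ → κ₂ * d ≡ κ₄ * d′) (sym d₁≡) (sym d₃≡) (ratio₂ κ₁ κ₂ κ₃ κ₄))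
  η₃≡κ₃ : η₃ ≡ κ₃
  η₃≡κ₃ = proj₁ (lowestTerms-unique η₃⊥η₄ κ₃⊥κ₄ η₄>0 κ₄>0 (>0⇒≢0 (d₂>0 s s>0)) (ratio₃ η₁ η₂ η₃ η₄)
    (subst₂ (λ d d′ → κ₃ * d ≡ κ₄ * d′) (sym d₂≡) (sym d₃≡) (ratio₃ κ₁ κ₂ κ₃ κ₄)))
  η₁≡κ₁ : η₁ ≡ κ₁
  η₁≡κ₁ = *-cancelʳ-≢0 (*-≢0 (>0⇒≢0 η₃>0) (>0⇒≢0 η₄>0)) (begin
    η₁ * (η₃ * η₄)   ≡⟨ *-assoc η₁ η₃ η₄ ⟨
    η₁ * η₃ * η₄     ≡⟨ d₁≡ ⟩
    κ₁ * κ₃ * κ₄     ≡⟨ *-assoc κ₁ κ₃ κ₄ ⟩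
    κ₁ * (κ₃ * κ₄)   ≡⟨ cong₂ (λ a b → κ₁ * (a * b)) (sym η₃≡κ₃) (sym (proj₂ η₂₄≡κ₂₄)) ⟩
    κ₁ * (η₃ * η₄)   ∎)
    where open ≡-Reasoning

uniqueness : ∀ x → x 5F ≢ 0ℤ → Binomial x → ∀ s t → Good x s → Good x t → s ≡ t
uniqueness x x₅≢0 x-binomial s@(tor α₁ α₂ α₃ η₁ η₂ η₃ η₄) t@(tor β₁ β₂ β₃ κ₁ κ₂ κ₃ κ₄)
  (_ , s∼x , α₁⊥ , α₂⊥ , α₃⊥ , _ , η₂⊥η₄ , η₃⊥η₄ , η₁>0 , η₂>0 , η₃>0 , η₄>0 , _)
  (_ , t∼x , β₁⊥ , β₂⊥ , β₃⊥ , _ , κ₂⊥κ₄ , κ₃⊥κ₄ , κ₁>0 , κ₂>0 , κ₃>0 , κ₄>0 , _) =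
  tor-cong (proj₁ αd₁) (proj₁ αd₂) (proj₁ αd₃) η₁≡κ₁ η₂≡κ₂ η₃≡κ₃ η₄≡κ₄
  where
  s>0 : PositiveWeights s
  s>0 = η₁>0 , η₂>0 , η₃>0 , η₄>0
  t>0 : PositiveWeights t
  t>0 = κ₁>0 , κ₂>0 , κ₃>0 , κ₄>0
  open Equivalence using (to)
  fs = to (projEq⇔fractions x s s>0 x₅≢0 x-binomial) s∼x
  ft = to (projEq⇔fractions x t t>0 x₅≢0 x-binomial) t∼x
  αd₁ : α₁ ≡ β₁ × d₁ s ≡ d₁ t
  αd₁ = lowestTerms-unique α₁⊥ β₁⊥ (d₁>0 s s>0) (d₁>0 t t>0) x₅≢0 (proj₁ fs) (proj₁ ft)
  αd₂ : α₂ ≡ β₂ × d₂ s ≡ d₂ t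
  αd₂ = lowestTerms-unique α₂⊥ β₂⊥ (d₂>0 s s>0) (d₂>0 t t>0) x₅≢0 (proj₁ (proj₂ fs))
    (subst (λ d → β₂ * x 5F ≡ d₂ t * (d * x 3F)) (sym (proj₂ αd₁)) (proj₁ (proj₂ ft)))
  αd₃ : α₃ ≡ β₃ × d₃ s ≡ d₃ t
  αd₃ = lowestTerms-unique α₃⊥ β₃⊥ (d₃>0 s s>0) (d₃>0 t t>0) x₅≢0 (proj₂ (proj₂ fs))
    (subst (λ d → β₃ * x 5F ≡ d₃ t * (d * x 4F)) (sym (proj₂ αd₁)) (proj₂ (proj₂ ft)))
  η≡κ = weights-unique s t s>0 t>0 η₂⊥η₄ η₃⊥η₄ κ₂⊥κ₄ κ₃⊥κ₄ (proj₂ αd₁) (proj₂ αd₂) (proj₂ αd₃)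
  η₁≡κ₁ = proj₁ η≡κ
  η₂≡κ₂ = proj₁ (proj₂ η≡κ)
  η₃≡κ₃ = proj₁ (proj₂ (proj₂ η≡κ))
  η₄≡κ₄ = proj₂ (proj₂ (proj₂ η≡κ))

lemma3p2 : (x : Coords) → OnS x → AllNonzero x →
    Σ Tor λ t → Good x t × ((s : Tor) → Good x s → s ≡ t)
lemma3p2 x onS x≢0 =
  let t , good-t = existence x onS x≢0
  in t , good-t , λ s good-s → uniqueness x (x≢0 5F) (onS⇒binomial x onS) s t good-s good-t
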